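{- Let $m\ge1$, $n\ge0$. The number of Galois connections between an $(n+1)$-element chain and the $m$-balloon $\mathcal{B}_m^{(1)}$ (equivalently, between the concept lattices of the contraordinal scales of an $n$-chain and of an $m$-star) is $\sum_{k=1}^{n+1}k^m$.
   Context: A Galois connection between posets $(P,\le_P)$ and $(Q,\le_Q)$ is a pair of maps $\varphi:P\to Q$, $\psi:Q\to P$ such that $p_1\le_P p_2$ implies $\varphi p_1\ge_Q\varphi p_2$, $q_1\le_Q q_2$ implies $\psi q_1\ge_P\psi q_2$, and $p\le_P\psi\varphi p$, $q\le_Q\varphi\psi q$ for all $p,p_i\in P$, $q,q_i\in Q$. The $m$-balloon $\mathcal{B}_m^{(1)}$ is the lattice obtained from the Boolean lattice with $2^m$ elements by replacing its bottom element by a $2$-element chain (so it has $2^m+1$ elements: a new bottom element below the old bottom). This lattice is isomorphic to the concept lattice of the formal context $(S,S,\not\ge)$ for the $m$-star $S=\{s_0,\dots,s_m\}$ ($s\le s'$ iff $s=s'$ or $s=s_0$), and the $(n+1)$-chain is isomorphic to the concept lattice of $(C,C,\not\ge)$ for the $n$-chain $C=\{c_1<\dots<c_n\}$. -}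

module Defs where

open import Level using (0ℓ)
open import Data.Nat using (ℕ; zero; suc; _^_; _+_)
open import Data.List using (map; upTo)
open import Data.Nat.ListAction using (sum)
open import Data.Fin using (Fin)
import Data.Fin as F
open import Data.Fin.Subset using (Subset; _⊆_)
open import Data.Maybe using (Maybe; just; nothing)
open import Data.Product using (_×_; _,_)
open import Data.Empty using (⊥)
open import Data.Unit using (⊤)
open import Relation.Binary using (Rel; Setoid)
open import Relation.Binary.PropositionalEquality using (_≡_; refl; sym; trans)

record GaloisConnection {P Q : Set} (_≤P_ : Rel P 0ℓ) (_≤Q_ : Rel Q 0ℓ) : Set where
  field
    φ : P → Q
    ψ : Q → P
    φ-antitone : ∀ {p₁ p₂} → p₁ ≤P p₂ → φ p₂ ≤Q φ p₁
    ψ-antitone : ∀ {q₁ q₂} → q₁ ≤Q q₂ → ψ q₂ ≤P ψ q₁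
    extensiveP : ∀ p → p ≤P ψ (φ p)
    extensiveQ : ∀ q → q ≤Q φ (ψ q)

open GaloisConnection public

GC-setoid : {P Q : Set} (_≤P_ : Rel P 0ℓ) (_≤Q_ : Rel Q 0ℓ) → Setoid 0ℓ 0ℓ
GC-setoid {P} {Q} _≤P_ _≤Q_ = record
  { Carrier = GaloisConnection _≤P_ _≤Q_
  ; _≈_ = λ g h → ((p : P) → φ g p ≡ φ h p) × ((q : Q) → ψ g q ≡ ψ h q)
  ; isEquivalence = record
    { refl = (λ _ → refl) , (λ _ → refl)
    ; sym = λ { (a , b) → (λ p → sym (a p)) , (λ q → sym (b q)) }
    ; trans = λ { (a , b) (c , d) → (λ p → trans (a p) (c p)) , (λ q → trans (b q) (d q)) }
    }
  }

Chain : ℕ → Set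
Chain n = Fin (suc n)

_≤C_ : {n : ℕ} → Rel (Chain n) 0ℓ
_≤C_ = F._≤_

-- The m-balloon B_m^(1): the Boolean lattice of subsets of an m-set
-- (just A), with a new bottom element (nothing) adjoined below it.
Balloon : ℕ → Set
Balloon m = Maybe (Subset m)

_≤B_ : {m : ℕ} → Rel (Balloon m) 0ℓ
nothing ≤B _        = ⊤
just _  ≤B nothing  = ⊥
just A  ≤B just B   = A ⊆ B

powerSum : ℕ → ℕ → ℕ
powerSum n m = sum (map (λ k → suc k ^ m) (upTo (suc n)))

module Submission where

-- Galois connections between the (n+1)-chain C and the m-balloon B are
-- counted by exhibiting an explicit normal form for them.
--
-- A Galois connection (φ, ψ) is the same as an adjunction
-- q ≤ φ p ⟺ p ≤ ψ q, so φ is determined by ψ.  In B every element just A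
-- is the join of the bottom subset just ∅ and the atoms just ⁅ i ⁆, and
-- ψ turns joins into meets; hence ψ, and therefore the whole connection,
-- is determined by the threshold J = ψ (just ∅) ∈ C together with the m
-- values ψ (just ⁅ i ⁆) ≤ J.  Conversely every such datum (J, c) is
-- realised: ψ (just A) = min (J, min_{i ∈ A} c i), ψ nothing = top, and
-- φ p = just {i | p ≤ c i} for p ≤ J, φ p = nothing otherwise.
--
-- This yields an equivalence between
-- Galois connections and codes Σ (j : C) (Vec (Fin (j+1)) m); counting
-- codes block by block gives ∑_{k=1}^{n+1} k^m.

open import Defs
open import Data.Nat using (ℕ; _≤_)
open import Data.Fin using (Fin)
open import Function.Bundles using (Inverse)
open import Relation.Binary.PropositionalEquality using (setoid)

open import Level using (0ℓ)
open import Function using (_∘_; _⇔_; _↔_; mk⇔; mk↔ₛ′; Equivalence)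
open import Function.Properties.Inverse using (↔-refl; ↔-sym; ↔-trans)
open import Function.Properties.Equivalence using () renaming (sym to ⇔-sym; trans to ⇔-trans)
import Function.Construct.Composition as Composition
open import Data.Nat as ℕ using (zero; suc; _^_; _⊓_; s≤s)
import Data.Nat.Properties as ℕP
open import Data.Fin as F using (toℕ; fromℕ; fromℕ<; funToFin; finToFun)
import Data.Fin.Properties as FP
open import Data.Fin.Subset using (Subset; ⁅_⁆; _∈_; inside; outside) renaming (⊥ to ∅)
import Data.Fin.Subset.Properties as SP
open import Data.Vec using (Vec; []; _∷_; here; there; lookup; tabulate)
import Data.Vec.Properties as VP
open import Data.List using (map; applyUpTo)
open import Data.Nat.ListAction using (sum)
open import Data.Maybe using (just; nothing)
open import Data.Product using (Σ; _×_; _,_; proj₁; proj₂)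
open import Data.Product.Function.Dependent.Propositional using (Σ-↔)
open import Data.Sum using (_⊎_; inj₁; inj₂)
open import Data.Sum.Function.Propositional using (_⊎-↔_)
open import Data.Unit using (tt)
open import Data.Empty using (⊥-elim)
open import Relation.Nullary using (yes; no)
open import Relation.Nullary.Decidable using (isYes; toWitness; fromWitness)
open import Data.Bool.Properties using (T-≡)
open import Relation.Unary using (Pred; Decidable)
open import Relation.Binary using (Rel; Setoid; Reflexive; Transitive; Antisymmetric)
open import Relation.Binary.PropositionalEquality
  using (_≡_; _≗_; refl; sym; trans; cong; cong₂; subst)

open Equivalence using (to; from)

indirect-eq : {A : Set} {_≼_ : Rel A 0ℓ} → Reflexive _≼_ → Antisymmetric _≡_ _≼_ →
              ∀ {x y} → (∀ p → p ≼ x ⇔ p ≼ y) → x ≡ y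
indirect-eq refl≼ antisym {x} {y} same = antisym (to (same x) refl≼) (from (same y) refl≼)

module Adjunction {P Q : Set} {_≤P_ : Rel P 0ℓ} {_≤Q_ : Rel Q 0ℓ}
                  (reflP : Reflexive _≤P_) (transP : Transitive _≤P_)
                  (reflQ : Reflexive _≤Q_) (transQ : Transitive _≤Q_) where

  adjoint : (g : GaloisConnection _≤P_ _≤Q_) → ∀ p q → q ≤Q φ g p ⇔ p ≤P ψ g q
  adjoint g p q = mk⇔ (λ q≤φp → transP (extensiveP g p) (ψ-antitone g q≤φp))
                      (λ p≤ψq → transQ (extensiveQ g q) (φ-antitone g p≤ψq))

  fromAdjunction : (φ′ : P → Q) (ψ′ : Q → P) → (∀ p q → q ≤Q φ′ p ⇔ p ≤P ψ′ q) →
                   GaloisConnection _≤P_ _≤Q_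
  fromAdjunction φ′ ψ′ adj = record
    { φ = φ′
    ; ψ = ψ′
    ; φ-antitone = λ {p₁} {p₂} p₁≤p₂ → from (adj p₁ (φ′ p₂)) (transP p₁≤p₂ (unit p₂))
    ; ψ-antitone = λ {q₁} {q₂} q₁≤q₂ → to (adj (ψ′ q₂) q₁) (transQ q₁≤q₂ (counit q₂))
    ; extensiveP = unit
    ; extensiveQ = counit
    }
    where
      unit : ∀ p → p ≤P ψ′ (φ′ p)
      unit p = to (adj p (φ′ p)) reflQ
      counit : ∀ q → q ≤Q φ′ (ψ′ q)
      counit q = from (adj (ψ′ q) q) reflP

  -- φ p is the greatest q with p ≤ ψ q, so equal ψ's force equal φ's.
  φ-unique : Antisymmetric _≡_ _≤Q_ → (g h : GaloisConnection _≤P_ _≤Q_) →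
             ψ g ≗ ψ h → φ g ≗ φ h
  φ-unique antisymQ g h ψg≗ψh p = indirect-eq reflQ antisymQ λ q → mk⇔
    (λ q≤φgp → from (adjoint h p q) (subst (p ≤P_) (ψg≗ψh q) (to (adjoint g p q) q≤φgp)))
    (λ q≤φhp → from (adjoint g p q) (subst (p ≤P_) (sym (ψg≗ψh q)) (to (adjoint h p q) q≤φhp)))

≤B-refl : ∀ {m} → Reflexive (_≤B_ {m})
≤B-refl {x = nothing} = tt
≤B-refl {x = just A}  = λ a∈A → a∈A

≤B-trans : ∀ {m} → Transitive (_≤B_ {m})
≤B-trans {i = nothing}                           _   _   = tt
≤B-trans {i = just A} {j = just B} {k = just C} A⊆B B⊆C = B⊆C ∘ A⊆B

≤B-antisym : ∀ {m} → Antisymmetric _≡_ (_≤B_ {m})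
≤B-antisym {i = nothing} {j = nothing} _   _   = refl
≤B-antisym {i = just A}  {j = just B}  A⊆B B⊆A = cong just (SP.⊆-antisym A⊆B B⊆A)

just-decompose : ∀ {m} (A : Subset m) (x : Balloon m) →
                 just A ≤B x ⇔ ((just ∅ ≤B x) × (∀ {i} → i ∈ A → just ⁅ i ⁆ ≤B x))
just-decompose A nothing  = mk⇔ (λ ()) (λ ())
just-decompose A (just B) = mk⇔
  (λ A⊆B → (λ {_} → SP.⊥⊆) , λ {i} i∈A {_} k∈⁅i⁆ →
     A⊆B (subst (_∈ A) (sym (SP.x∈⁅y⁆⇒x≡y i k∈⁅i⁆)) i∈A))
  (λ { (_ , atoms) i∈A → atoms i∈A (SP.x∈⁅x⁆ _) })

GC : ℕ → ℕ → Set
GC n m = GaloisConnection (_≤C_ {n}) (_≤B_ {m})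

_≈GC_ : ∀ {n m} → GC n m → GC n m → Set
_≈GC_ {n} {m} = Setoid._≈_ (GC-setoid (_≤C_ {n}) (_≤B_ {m}))

module _ {n m : ℕ} where
  open Adjunction {_≤P_ = _≤C_ {n}} {_≤Q_ = _≤B_ {m}} FP.≤-refl FP.≤-trans ≤B-refl ≤B-trans

  ψ-top : (g : GC n m) (p : Chain n) → p ≤C ψ g nothing
  ψ-top g p = to (adjoint g p nothing) tt

  ψ-meet : (g : GC n m) (p : Chain n) (A : Subset m) →
           p ≤C ψ g (just A) ⇔
           ((p ≤C ψ g (just ∅)) × (∀ {i} → i ∈ A → p ≤C ψ g (just ⁅ i ⁆)))
  ψ-meet g p A = mk⇔
    (λ p≤ψA → let (∅≤ , atoms≤) = to (just-decompose A (φ g p)) (from (adj (just A)) p≤ψA)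
              in to (adj (just ∅)) ∅≤ , λ {i} i∈A → to (adj (just ⁅ i ⁆)) (atoms≤ i∈A))
    (λ { (p≤ψ∅ , p≤ψatoms) → to (adj (just A)) (from (just-decompose A (φ g p))
           (from (adj (just ∅)) p≤ψ∅ , λ {i} i∈A → from (adj (just ⁅ i ⁆)) (p≤ψatoms i∈A))) })
    where
      adj : ∀ q → q ≤B φ g p ⇔ p ≤C ψ g q
      adj = adjoint g p

  GC-ext : (g h : GC n m) → ψ g (just ∅) ≡ ψ h (just ∅) →
           (∀ i → ψ g (just ⁅ i ⁆) ≡ ψ h (just ⁅ i ⁆)) → g ≈GC h
  GC-ext g h same∅ sameAtoms = φ-unique ≤B-antisym g h ψ-eq , ψ-eq
    where
      transport : (g′ h′ : GC n m) → ψ g′ (just ∅) ≡ ψ h′ (just ∅) →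
                  (∀ i → ψ g′ (just ⁅ i ⁆) ≡ ψ h′ (just ⁅ i ⁆)) →
                  ∀ p A → p ≤C ψ g′ (just A) → p ≤C ψ h′ (just A)
      transport g′ h′ e∅ eAtoms p A p≤ψA =
        let (p≤ψ∅ , p≤ψatoms) = to (ψ-meet g′ p A) p≤ψA
        in from (ψ-meet h′ p A) ( subst (p ≤C_) e∅ p≤ψ∅
                                , λ {i} i∈A → subst (p ≤C_) (eAtoms i) (p≤ψatoms i∈A))
      ψ-eq : ψ g ≗ ψ h
      ψ-eq nothing  = indirect-eq FP.≤-refl FP.≤-antisym λ p →
        mk⇔ (λ _ → ψ-top h p) (λ _ → ψ-top g p)
      ψ-eq (just A) = indirect-eq FP.≤-refl FP.≤-antisym λ p → mk⇔
        (transport g h same∅ sameAtoms p A)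
        (transport h g (sym same∅) (sym ∘ sameAtoms) p A)

meet : ∀ {m} → ℕ → Subset m → (Fin m → ℕ) → ℕ
meet J []            c = J
meet J (inside ∷ A)  c = c F.zero ⊓ meet J A (c ∘ F.suc)
meet J (outside ∷ A) c = meet J A (c ∘ F.suc)

LowerBound : ∀ {m} → ℕ → ℕ → Subset m → (Fin m → ℕ) → Set
LowerBound p J A c = (p ≤ J) × (∀ {i} → i ∈ A → p ≤ c i)

meet-glb : ∀ {m} J (A : Subset m) c p → p ≤ meet J A c ⇔ LowerBound p J A c
meet-glb J [] c p = mk⇔ (λ p≤J → p≤J , λ ()) proj₁
meet-glb J (inside ∷ A) c p = mk⇔ down up
  where
    rest : p ≤ meet J A (c ∘ F.suc) ⇔ LowerBound p J A (c ∘ F.suc)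
    rest = meet-glb J A (c ∘ F.suc) p
    down : p ≤ c F.zero ⊓ meet J A (c ∘ F.suc) → LowerBound p J (inside ∷ A) c
    down p≤meet = proj₁ below-rest , bound
      where
        below-rest : LowerBound p J A (c ∘ F.suc)
        below-rest = to rest (ℕP.m≤n⊓o⇒m≤o _ _ p≤meet)
        bound : ∀ {i} → i ∈ inside ∷ A → p ≤ c i
        bound here        = ℕP.m≤n⊓o⇒m≤n _ _ p≤meet
        bound (there i∈A) = proj₂ below-rest i∈A
    up : LowerBound p J (inside ∷ A) c → p ≤ c F.zero ⊓ meet J A (c ∘ F.suc)
    up (p≤J , p≤c) = ℕP.⊓-glb (p≤c here) (from rest (p≤J , λ i∈A → p≤c (there i∈A)))
meet-glb J (outside ∷ A) c p = mk⇔ down up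
  where
    rest : p ≤ meet J A (c ∘ F.suc) ⇔ LowerBound p J A (c ∘ F.suc)
    rest = meet-glb J A (c ∘ F.suc) p
    down : p ≤ meet J A (c ∘ F.suc) → LowerBound p J (outside ∷ A) c
    down p≤meet = proj₁ (to rest p≤meet) , bound
      where
        bound : ∀ {i} → i ∈ outside ∷ A → p ≤ c i
        bound (there i∈A) = proj₂ (to rest p≤meet) i∈A
    up : LowerBound p J (outside ∷ A) c → p ≤ meet J A (c ∘ F.suc)
    up (p≤J , p≤c) = from rest (p≤J , λ i∈A → p≤c (there i∈A))

meet≤J : ∀ {m} J (A : Subset m) c → meet J A c ≤ J
meet≤J J A c = proj₁ (to (meet-glb J A c _) ℕP.≤-refl)

meet-∅ : ∀ {m} J (c : Fin m → ℕ) → meet J ∅ c ≡ J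
meet-∅ J c = indirect-eq ℕP.≤-refl ℕP.≤-antisym λ p →
  mk⇔ (proj₁ ∘ to (meet-glb J ∅ c p))
      (λ p≤J → from (meet-glb J ∅ c p) (p≤J , ⊥-elim ∘ SP.∉⊥))

meet-⁅⁆ : ∀ {m} J (c : Fin m → ℕ) i → c i ≤ J → meet J ⁅ i ⁆ c ≡ c i
meet-⁅⁆ J c i cᵢ≤J = indirect-eq ℕP.≤-refl ℕP.≤-antisym λ p → mk⇔
  (λ p≤meet → proj₂ (to (meet-glb J ⁅ i ⁆ c p) p≤meet) (SP.x∈⁅x⁆ i))
  (λ p≤cᵢ → from (meet-glb J ⁅ i ⁆ c p)
    ( ℕP.≤-trans p≤cᵢ cᵢ≤J
    , λ k∈⁅i⁆ → subst (λ k → p ≤ c k) (sym (SP.x∈⁅y⁆⇒x≡y i k∈⁅i⁆)) p≤cᵢ))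

select : ∀ {m} {P : Pred (Fin m) 0ℓ} → Decidable P → Subset m
select P? = tabulate (isYes ∘ P?)

∈-select : ∀ {m} {P : Pred (Fin m) 0ℓ} (P? : Decidable P) i → i ∈ select P? ⇔ P i
∈-select P? i = mk⇔
  (λ i∈ → toWitness (from T-≡ (trans (sym entry) (VP.[]=⇒lookup i∈))))
  (λ Pi → VP.lookup⇒[]= i _ (trans entry (to T-≡ (fromWitness Pi))))
  where
    entry : lookup (select P?) i ≡ isYes (P? i)
    entry = VP.lookup∘tabulate (isYes ∘ P?) i

module Realise {n m : ℕ} (J : Chain n) (c : Fin m → ℕ) where
  open Adjunction {_≤P_ = _≤C_ {n}} {_≤Q_ = _≤B_ {m}} FP.≤-refl FP.≤-trans ≤B-refl ≤B-trans

  φ′ : Chain n → Balloon m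
  φ′ p with p FP.≤? J
  ... | yes _ = just (select (λ i → toℕ p ℕ.≤? c i))
  ... | no _  = nothing

  φ′-char : ∀ p A → just A ≤B φ′ p ⇔ LowerBound (toℕ p) (toℕ J) A c
  φ′-char p A with p FP.≤? J
  ... | no p≰J  = mk⇔ (λ ()) (λ below → p≰J (proj₁ below))
  ... | yes p≤J = mk⇔
    (λ A⊆sel → p≤J , λ {i} i∈A → to (∈-select _ i) (A⊆sel i∈A))
    (λ below {i} i∈A → from (∈-select _ i) (proj₂ below i∈A))

  ψ′ : Balloon m → Chain n
  ψ′ nothing  = fromℕ n
  ψ′ (just A) = fromℕ< (s≤s (ℕP.≤-trans (meet≤J (toℕ J) A c) (FP.toℕ≤pred[n] J)))

  toℕ-ψ′ : ∀ A → toℕ (ψ′ (just A)) ≡ meet (toℕ J) A c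
  toℕ-ψ′ A = FP.toℕ-fromℕ< _

  adjunction : ∀ p q → q ≤B φ′ p ⇔ p ≤C ψ′ q
  adjunction p nothing  = mk⇔ (λ _ → FP.≤fromℕ p) (λ _ → tt)
  adjunction p (just A) =
    ⇔-trans (φ′-char p A) (⇔-trans (⇔-sym (meet-glb (toℕ J) A c (toℕ p)))
      (mk⇔ (subst (toℕ p ≤_) (sym (toℕ-ψ′ A))) (subst (toℕ p ≤_) (toℕ-ψ′ A))))

  galois : GC n m
  galois = fromAdjunction φ′ ψ′ adjunction

  ψ-∅ : ψ galois (just ∅) ≡ J
  ψ-∅ = FP.toℕ-injective (trans (toℕ-ψ′ ∅) (meet-∅ (toℕ J) c))

  ψ-atom : ∀ i → c i ≤ toℕ J → toℕ (ψ galois (just ⁅ i ⁆)) ≡ c i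
  ψ-atom i cᵢ≤J = trans (toℕ-ψ′ ⁅ i ⁆) (meet-⁅⁆ (toℕ J) c i cᵢ≤J)

Code : ℕ → ℕ → Set
Code n m = Σ (Chain n) (λ j → Vec (Fin (suc (toℕ j))) m)

truncate : ∀ {n} (j : Chain n) → ℕ → Fin (suc (toℕ j))
truncate j x = fromℕ< (s≤s (ℕP.m⊓n≤n x (toℕ j)))

toℕ-truncate : ∀ {n} (j : Chain n) {x} → x ≤ toℕ j → toℕ (truncate j x) ≡ x
toℕ-truncate j x≤j = trans (FP.toℕ-fromℕ< _) (ℕP.m≤n⇒m⊓n≡m x≤j)

code : ∀ {n m} (j : Chain n) (w : Fin m → ℕ) → Code n m
code j w = j , tabulate (truncate j ∘ w)

code-cong : ∀ {n m} {j j′ : Chain n} {w w′ : Fin m → ℕ} →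
            j ≡ j′ → w ≗ w′ → code j w ≡ code j′ w′
code-cong refl w≗w′ = cong (_ ,_) (VP.tabulate-cong (cong (truncate _) ∘ w≗w′))

code-entry : ∀ {n m} (j : Chain n) (w : Fin m → ℕ) i → w i ≤ toℕ j →
             toℕ (lookup (proj₂ (code j w)) i) ≡ w i
code-entry j w i wᵢ≤j =
  trans (cong toℕ (VP.lookup∘tabulate (truncate j ∘ w) i)) (toℕ-truncate j wᵢ≤j)

entry-bound : ∀ {k m} (v : Vec (Fin (suc k)) m) i → toℕ (lookup v i) ≤ k
entry-bound v i = ℕ.s≤s⁻¹ (FP.toℕ<n (lookup v i))

code-lookup : ∀ {n m} (j : Chain n) (v : Vec (Fin (suc (toℕ j))) m) →
              code j (toℕ ∘ lookup v) ≡ (j , v)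
code-lookup j v = cong (j ,_) (trans
  (VP.tabulate-cong λ i → FP.toℕ-injective (toℕ-truncate j (entry-bound v i)))
  (VP.tabulate∘lookup v))

-- A Galois connection is coded by ψ (just ∅) and the ψ (just ⁅ i ⁆);
-- the latter lie below ψ (just ∅) by antitonicity, so nothing is truncated.
toCode : ∀ {n m} → GC n m → Code n m
toCode g = code (ψ g (just ∅)) (λ i → toℕ (ψ g (just ⁅ i ⁆)))

fromCode : ∀ {n m} → Code n m → GC n m
fromCode (j , v) = Realise.galois j (toℕ ∘ lookup v)

to-from : ∀ {n m} (x : Code n m) → toCode (fromCode x) ≡ x
to-from (j , v) = trans
  (code-cong (Realise.ψ-∅ j (toℕ ∘ lookup v)) (λ i → Realise.ψ-atom j _ i (entry-bound v i)))
  (code-lookup j v)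

from-to : ∀ {n m} (g : GC n m) → fromCode (toCode g) ≈GC g
from-to {n} {m} g = GC-ext (fromCode (toCode g)) g (Realise.ψ-∅ J c) λ i →
  FP.toℕ-injective (trans (Realise.ψ-atom J c i (entry-bound v i))
                          (code-entry J _ i (ψ-antitone g (λ {_} → SP.⊥⊆))))
  where
    J : Chain n
    J = proj₁ (toCode g)
    v : Vec (Fin (suc (toℕ J))) m
    v = proj₂ (toCode g)
    c : Fin m → ℕ
    c = toℕ ∘ lookup v

galois↔code : ∀ n m → Inverse (GC-setoid (_≤C_ {n}) (_≤B_ {m})) (setoid (Code n m))
galois↔code n m = record
  { to        = toCode
  ; from      = fromCode
  ; to-cong   = λ {g} {h} → toCode-cong {g} {h}
  ; from-cong = λ { {x} refl → Setoid.refl (GC-setoid (_≤C_ {n}) (_≤B_ {m})) {fromCode x} }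
  ; inverse   = (λ {x} {y} y≈ → trans (toCode-cong {y} {fromCode x} y≈) (to-from x))
                , λ { {x} refl → from-to x }
  }
  where
    toCode-cong : ∀ {g h : GC n m} → g ≈GC h → toCode g ≡ toCode h
    toCode-cong (_ , ψ≗) = code-cong (ψ≗ (just ∅)) (λ i → cong toℕ (ψ≗ (just ⁅ i ⁆)))

funToFin-cong : ∀ {k m} {f g : Fin m → Fin k} → f ≗ g → funToFin f ≡ funToFin g
funToFin-cong {m = zero}  f≗g = refl
funToFin-cong {m = suc m} f≗g = cong₂ F.combine (f≗g F.zero) (funToFin-cong (f≗g ∘ F.suc))

vec↔ : ∀ k m → Vec (Fin k) m ↔ Fin (k ^ m)
vec↔ k m = mk↔ₛ′ (funToFin ∘ lookup) (tabulate ∘ finToFun)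
  (λ x → trans (funToFin-cong {k} {m} (VP.lookup∘tabulate (finToFun x)))
               (FP.funToFin-finToFin {m} {k} x))
  (λ v → trans (VP.tabulate-cong (FP.finToFun-funToFin (lookup v))) (VP.tabulate∘lookup v))

Σ-Fin-suc↔ : ∀ {k} {B : Fin (suc k) → Set} →
             Σ (Fin (suc k)) B ↔ (B F.zero ⊎ Σ (Fin k) (B ∘ F.suc))
Σ-Fin-suc↔ {k} {B} = mk↔ₛ′ split unsplit split∘unsplit unsplit∘split
  where
    split : Σ (Fin (suc k)) B → B F.zero ⊎ Σ (Fin k) (B ∘ F.suc)
    split (F.zero  , b) = inj₁ b
    split (F.suc j , b) = inj₂ (j , b)
    unsplit : B F.zero ⊎ Σ (Fin k) (B ∘ F.suc) → Σ (Fin (suc k)) B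
    unsplit (inj₁ b)       = F.zero , b
    unsplit (inj₂ (j , b)) = F.suc j , b
    split∘unsplit : ∀ x → split (unsplit x) ≡ x
    split∘unsplit (inj₁ _) = refl
    split∘unsplit (inj₂ _) = refl
    unsplit∘split : ∀ x → unsplit (split x) ≡ x
    unsplit∘split (F.zero  , _) = refl
    unsplit∘split (F.suc _ , _) = refl

blocks↔ : (f g : ℕ → ℕ) (k : ℕ) →
          Σ (Fin k) (λ j → Fin (f (g (toℕ j)))) ↔ Fin (sum (map f (applyUpTo g k)))
blocks↔ f g zero    = mk↔ₛ′ (λ ()) (λ ()) (λ ()) (λ ())
blocks↔ f g (suc k) =
  ↔-trans Σ-Fin-suc↔ (↔-trans (↔-refl ⊎-↔ blocks↔ f (g ∘ suc) k) (↔-sym FP.+↔⊎))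

code↔Fin : ∀ n m → Code n m ↔ Fin (powerSum n m)
code↔Fin n m = ↔-trans (Σ-↔ ↔-refl (λ {j} → vec↔ (suc (toℕ j)) m))
                       (blocks↔ (λ k → suc k ^ m) (λ k → k) (suc n))

proposition5p1 : (m n : ℕ) → 1 ≤ m →
    Inverse (GC-setoid (_≤C_ {n}) (_≤B_ {m})) (setoid (Fin (powerSum n m)))
proposition5p1 m n _ = Composition.inverse (galois↔code n m) (code↔Fin n m)
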